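{- Let $\mathcal{S}$ be a system of equations (in standard form) and let $U, W$ be variables of $\mathcal{S}$ such that $U \succ_a W$ and $U \succ_{r_*} W$. Then $\mathcal{S}$ has no unifier modulo one-sided distributivity.
   Context: One-sided distributivity is the equational theory over the binary symbols $+,\times$ generated by $X \times (Y+Z) = X\times Y + X\times Z$; unification is elementary (terms over $+$, $\times$ and variables). A system in standard form is a finite set of equations each of the form $X=^?Y$ ($Y\ne X$), $X=^?Y+Z$ or $X=^?Y\times Z$ with $X,Y,Z$ variables. $U \succ_{r_*} W$ means $\mathcal{S}$ contains an equation $U =^? Z \times W$ for some variable $Z$; $U \succ_a W$ means $\mathcal{S}$ contains $U =^? Y + W$ or $U =^? W + Y$ for some variable $Y$. -}

module Defs where

open import Data.Nat using (ℕ)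
open import Data.List using (List)
open import Data.List.Relation.Unary.All using (All)
open import Data.List.Membership.Propositional using (_∈_)
open import Data.Product using (∃; ∃-syntax)
open import Data.Sum using (_⊎_)
open import Relation.Binary.PropositionalEquality using (_≡_)
open import Relation.Nullary using (¬_)
open import Data.Unit using (⊤)

Var : Set
Var = ℕ

infixl 6 _⊕_
infixl 7 _⊗_
data Term : Set where
  var : Var → Term
  _⊕_ : Term → Term → Term
  _⊗_ : Term → Term → Term

infix 4 _≈D_
data _≈D_ : Term → Term → Set where
  ≈-refl  : ∀ {s} → s ≈D s
  ≈-sym   : ∀ {s t} → s ≈D t → t ≈D s
  ≈-trans : ∀ {s t u} → s ≈D t → t ≈D u → s ≈D u
  ≈-cong⊕ : ∀ {s s′ t t′} → s ≈D s′ → t ≈D t′ → s ⊕ t ≈D s′ ⊕ t′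
  ≈-cong⊗ : ∀ {s s′ t t′} → s ≈D s′ → t ≈D t′ → s ⊗ t ≈D s′ ⊗ t′
  ≈-dist  : ∀ x y z → x ⊗ (y ⊕ z) ≈D (x ⊗ y) ⊕ (x ⊗ z)

-- Equations of a system in standard form:
--   eqV X Y : X =? Y,   eqP X Y Z : X =? Y + Z,   eqT X Y Z : X =? Y × Z.
data Equation : Set where
  eqV : Var → Var → Equation
  eqP : Var → Var → Var → Equation
  eqT : Var → Var → Var → Equation

System : Set
System = List Equation

WellFormedEq : Equation → Set
WellFormedEq (eqV X Y) = ¬ (Y ≡ X)
WellFormedEq (eqP _ _ _) = ⊤
WellFormedEq (eqT _ _ _) = ⊤

StandardForm : System → Set
StandardForm S = All WellFormedEq S

Subst : Set
Subst = Var → Term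

_⟨_⟩ : Subst → Term → Term
σ ⟨ var x ⟩ = σ x
σ ⟨ s ⊕ t ⟩ = σ ⟨ s ⟩ ⊕ σ ⟨ t ⟩
σ ⟨ s ⊗ t ⟩ = σ ⟨ s ⟩ ⊗ σ ⟨ t ⟩

Solves : Subst → Equation → Set
Solves σ (eqV X Y)   = σ X ≈D σ Y
Solves σ (eqP X Y Z) = σ X ≈D σ Y ⊕ σ Z
Solves σ (eqT X Y Z) = σ X ≈D σ Y ⊗ σ Z

IsUnifier : Subst → System → Set
IsUnifier σ S = All (Solves σ) S

HasUnifier : System → Set
HasUnifier S = ∃[ σ ] IsUnifier σ S

_⊢_≻r*_ : System → Var → Var → Set
S ⊢ U ≻r* W = ∃[ Z ] (eqT U Z W ∈ S)

_⊢_≻a_ : System → Var → Var → Set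
S ⊢ U ≻a W = ∃[ Y ] ((eqP U Y W ∈ S) ⊎ (eqP U W Y ∈ S))

-- Count the summands a term has once every product is distributed over its
-- right factor; one-sided distributivity preserves this count.  A unifier σ
-- would make σ Y + σ W (or σ W + σ Y) equal to σ Z × σ W, but the former has
-- strictly more summands than σ W and the latter exactly as many.
module Submission where

open import Defs
open import Relation.Nullary using (¬_)
open import Data.Nat using (ℕ; _+_; _<_; z<s)
open import Data.Nat.Properties using (m≤m+n; m<m+n; m<n+m; <-≤-trans; <⇒≢)
open import Data.List.Relation.Unary.All using (lookup)
open import Data.Product using (_,_)
open import Data.Sum using (inj₁; inj₂)
open import Relation.Binary.PropositionalEquality using (_≡_; refl; sym; trans; cong₂)

#summands : Term → ℕ
#summands (var _) = 1
#summands (s ⊕ t) = #summands s + #summands t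
#summands (s ⊗ t) = #summands t

≈D⇒#summands≡ : ∀ {s t} → s ≈D t → #summands s ≡ #summands t
≈D⇒#summands≡ ≈-refl          = refl
≈D⇒#summands≡ (≈-sym p)       = sym (≈D⇒#summands≡ p)
≈D⇒#summands≡ (≈-trans p q)   = trans (≈D⇒#summands≡ p) (≈D⇒#summands≡ q)
≈D⇒#summands≡ (≈-cong⊕ p q)   = cong₂ _+_ (≈D⇒#summands≡ p) (≈D⇒#summands≡ q)
≈D⇒#summands≡ (≈-cong⊗ _ q)   = ≈D⇒#summands≡ q
≈D⇒#summands≡ (≈-dist _ _ _)  = refl

0<#summands : ∀ t → 0 < #summands t
0<#summands (var _) = z<s
0<#summands (s ⊕ t) = <-≤-trans (0<#summands s) (m≤m+n (#summands s) (#summands t))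
0<#summands (s ⊗ t) = 0<#summands t

≉⊗-of-fewer-summands : ∀ {s z w} → #summands w < #summands s → ¬ (s ≈D z ⊗ w)
≉⊗-of-fewer-summands w<s s≈z⊗w = <⇒≢ w<s (sym (≈D⇒#summands≡ s≈z⊗w))

lemma6p6 : (S : System) (U W : Var) → StandardForm S →
    S ⊢ U ≻a W → S ⊢ U ≻r* W → ¬ HasUnifier S
lemma6p6 S U W _ (Y , inj₁ U=Y⊕W) (Z , U=Z⊗W) (σ , σ-unifies) =
  ≉⊗-of-fewer-summands (m<n+m (#summands (σ W)) (0<#summands (σ Y)))
    (≈-trans (≈-sym (lookup σ-unifies U=Y⊕W)) (lookup σ-unifies U=Z⊗W))
lemma6p6 S U W _ (Y , inj₂ U=W⊕Y) (Z , U=Z⊗W) (σ , σ-unifies) =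
  ≉⊗-of-fewer-summands (m<m+n (#summands (σ W)) (0<#summands (σ Y)))
    (≈-trans (≈-sym (lookup σ-unifies U=W⊕Y)) (lookup σ-unifies U=Z⊗W))
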